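{- Let $k\ge 1$, $n\ge 3$ and $T_{3k,n}=C_{3k}\Box C_n$. Then $\chi(T_{3k,n}^2)\le 6$ if $n$ is even; $\chi(T_{3k,n}^2)\le 7$ if $n$ is odd and $n\ge 7$; $\chi(T_{3k,n}^2)\le 8$ if $n=5$; and $\chi(T_{3k,n}^2)\le 9$ if $n=3$.
   Context: $C_j$ denotes the cycle on $j$ vertices; $\Box$ is the Cartesian product of graphs. The square $G^2$ of a graph $G$ has vertex set $V(G)$, two distinct vertices being adjacent iff their distance in $G$ is at most 2. $\chi$ is the chromatic number. -}

module Defs where

open import Level using (0ℓ)
open import Data.Nat using (ℕ; zero; suc; _+_; _%_; NonZero)
open import Data.Fin using (Fin; toℕ)
open import Data.Product using (_×_; _,_; ∃; ∃-syntax)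
open import Data.Sum using (_⊎_)
open import Relation.Binary.PropositionalEquality using (_≡_; _≢_)
open import Relation.Nullary using (¬_)

record Graph : Set₁ where
  field
    V   : Set
    Adj : V → V → Set
open Graph public

-- Cycle C_j on vertices 0,…,j-1: u ~ v iff v ≡ u+1 (mod j) or u ≡ v+1 (mod j).
-- (Used only for j ≥ 3, where this is the usual cycle graph.)
CycleAdj : (j : ℕ) → .{{NonZero j}} → Fin j → Fin j → Set
CycleAdj j u v = (toℕ v ≡ (suc (toℕ u)) % j) ⊎ (toℕ u ≡ (suc (toℕ v)) % j)

Cycle : (j : ℕ) → .{{NonZero j}} → Graph
Cycle j = record { V = Fin j ; Adj = CycleAdj j }

_□_ : Graph → Graph → Graph
G □ H = record
  { V   = V G × V H
  ; Adj = λ { (g , h) (g' , h') → (Adj G g g' × h ≡ h') ⊎ (g ≡ g' × Adj H h h') }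
  }

square : Graph → Graph
square G = record
  { V   = V G
  ; Adj = λ u v → u ≢ v × (Adj G u v ⊎ (∃[ w ] (Adj G u w × Adj G w v)))
  }

IsProperColouring : (G : Graph) (c : ℕ) → (V G → Fin c) → Set
IsProperColouring G c f = ∀ u v → Adj G u v → f u ≢ f v

χ≤ : Graph → ℕ → Set
χ≤ G c = ∃[ f ] IsProperColouring G c f

T : (k n : ℕ) → .{{NonZero (3 Data.Nat.* k)}} → .{{NonZero n}} → Graph
T k n = Cycle (3 Data.Nat.* k) □ Cycle n

module Submission where

-- Write the vertices as (i , j) with i a row of C_{3k} and j a column of C_n.
-- All colourings here are "column colourings": column j receives a triple
-- of colours W j (a Column), and (i , j) gets the entry of W j indexed by
-- the residue of i mod 3.  Since 3 ∣ 3k, rows at distance one or two in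
-- C_{3k} have different residues, so the colouring is proper as soon as
-- every column is injective, consecutive columns use disjoint colour sets
-- and columns two apart differ in every row (a ProperTriple at each step).
--
-- Eventually periodic sequences can be certified locally
-- proper, and closing for a whole residue class of lengths, by a finite
-- computation (proper-by-check, closes-by-check).  The theorem follows from
-- four explicit sequences with 6, 7, 8 and 9 colours.

open import Defs
open import Data.Nat
  using (ℕ; suc; _+_; _*_; _∸_; _%_; _<_; _≤_; _≥_; z≤n; s≤s; NonZero; _<?_; _≤?_)
  renaming (_≟_ to _≟ℕ_)
open import Data.Nat.Properties
  using (+-comm; +-assoc; +-suc; ≤-refl; ≤-trans; m≤n+m; ≤-pred; ≤-antisym; ≮⇒≥; <-cmp; m+[n∸m]≡n;
         m+n≤o⇒m≤o∸n; m+n≤o⇒n≤o; ∸-monoʳ-<; allUpTo?)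
open import Data.Nat.DivMod
  using (_mod_; m%n<n; m<n⇒m%n≡m; n%n≡0; m%n%n≡m%n; [m+n]%n≡m%n; %-distribˡ-+; m∣n⇒o%n%m≡o%m)
open import Data.Nat.Divisibility using (_∣_; m∣m*n)
open import Data.Nat.Induction using (<-rec)
open import Data.Fin using (Fin; toℕ; #_)
open import Data.Fin.Properties using (toℕ-fromℕ<; toℕ-injective; toℕ<n; all?)
  renaming (_≟_ to _≟F_)
open import Data.Vec.Functional using (Vector; _∷_; [])
open import Data.Product using (_×_; _,_; proj₁; proj₂)
open import Data.Sum using (_⊎_; inj₁; inj₂)
open import Data.Empty using (⊥-elim)
open import Relation.Binary using (Tri; tri<; tri≈; tri>)
open import Relation.Binary.PropositionalEquality
  using (_≡_; _≢_; refl; sym; trans; cong; subst; ≢-sym; module ≡-Reasoning)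
open import Relation.Nullary using (Dec; yes; no; ¬?)
open import Relation.Nullary.Decidable using (True; toWitness; map′; _×-dec_; _→-dec_)
open import Relation.Unary using (Decidable)

open ≡-Reasoning

-- The three colours given to the rows 0, 1, 2 (mod 3) of one column.
Column : ℕ → Set
Column c = Vector (Fin c) 3

Distinct : ∀ {c} → Column c → Set
Distinct C = ∀ x y → x ≢ y → C x ≢ C y

Disjoint : ∀ {c} → Column c → Column c → Set
Disjoint C D = ∀ x y → C x ≢ D y

Apart : ∀ {c} → Column c → Column c → Set
Apart C D = ∀ x → C x ≢ D x

Disjoint-sym : ∀ {c} {C D : Column c} → Disjoint C D → Disjoint D C
Disjoint-sym disjoint x y = ≢-sym (disjoint y x)

Apart-sym : ∀ {c} {C D : Column c} → Apart C D → Apart D C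
Apart-sym apart x = ≢-sym (apart x)

-- What the square of the torus demands of a column C, the next column D and
-- the column E after that.
record ProperTriple {c} (C D E : Column c) : Set where
  constructor proper-triple
  field
    distinct : Distinct C
    disjoint : Disjoint C D
    apart    : Apart C E
open ProperTriple

ProperTriple-resp : ∀ {c} {C C′ D D′ E E′ : Column c} →
  C ≡ C′ → D ≡ D′ → E ≡ E′ → ProperTriple C D E → ProperTriple C′ D′ E′
ProperTriple-resp refl refl refl triple = triple

ProperAt : ∀ {c} → (ℕ → Column c) → ℕ → Set
ProperAt S t = ProperTriple (S t) (S (1 + t)) (S (2 + t))

LocallyProper : ∀ {c} → (ℕ → Column c) → Set
LocallyProper S = ∀ t → ProperAt S t

-- The columns S 0, …, S (1 + l) read cyclically also satisfy the
-- constraints across the seam between S (1 + l) and S 0.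
Closes : ∀ {c} → (ℕ → Column c) → ℕ → Set
Closes S l = Disjoint (S (1 + l)) (S 0) × Apart (S l) (S 0) × Apart (S (1 + l)) (S 1)

distinct? : ∀ {c} (C : Column c) → Dec (Distinct C)
distinct? C = all? λ x → all? λ y → ¬? (x ≟F y) →-dec ¬? (C x ≟F C y)

disjoint? : ∀ {c} (C D : Column c) → Dec (Disjoint C D)
disjoint? C D = all? λ x → all? λ y → ¬? (C x ≟F D y)

apart? : ∀ {c} (C D : Column c) → Dec (Apart C D)
apart? C D = all? λ x → ¬? (C x ≟F D x)

properAt? : ∀ {c} (S : ℕ → Column c) → Decidable (ProperAt S)
properAt? S t = map′ (λ (d , j , a) → proper-triple d j a) (λ p → distinct p , disjoint p , apart p)
  (distinct? (S t) ×-dec disjoint? (S t) (S (1 + t)) ×-dec apart? (S t) (S (2 + t)))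

closes? : ∀ {c} (S : ℕ → Column c) → Decidable (Closes S)
closes? S l = disjoint? (S (1 + l)) (S 0) ×-dec apart? (S l) (S 0) ×-dec apart? (S (1 + l)) (S 1)

%-absorbʳ : ∀ a b m .{{_ : NonZero m}} → (a + b % m) % m ≡ (a + b) % m
%-absorbʳ a b m = begin
  (a + b % m) % m          ≡⟨ %-distribˡ-+ a (b % m) m ⟩
  (a % m + b % m % m) % m  ≡⟨ cong (λ x → (a % m + x) % m) (m%n%n≡m%n b m) ⟩
  (a % m + b % m) % m      ≡⟨ %-distribˡ-+ a b m ⟨
  (a + b) % m              ∎

cyclic-predecessor : ∀ {m w} .{{_ : NonZero m}} → w < m → (m ∸ 1 + suc w % m) % m ≡ w
cyclic-predecessor {suc m′} {w} w<m = begin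
  (m′ + suc w % suc m′) % suc m′  ≡⟨ %-absorbʳ m′ (suc w) (suc m′) ⟩
  (m′ + suc w) % suc m′           ≡⟨ cong (_% suc m′) m′+1+w≡w+1+m′ ⟩
  (w + suc m′) % suc m′           ≡⟨ [m+n]%n≡m%n w (suc m′) ⟩
  w % suc m′                      ≡⟨ m<n⇒m%n≡m w<m ⟩
  w                               ∎
  where
  m′+1+w≡w+1+m′ : m′ + suc w ≡ w + suc m′
  m′+1+w≡w+1+m′ = trans (+-suc m′ w) (trans (cong suc (+-comm m′ w)) (sym (+-suc w m′)))

suc-mod-injective : ∀ {m u v} .{{_ : NonZero m}} → u < m → v < m → suc u % m ≡ suc v % m → u ≡ v
suc-mod-injective {m} {u} {v} u<m v<m eq = begin
  u                          ≡⟨ cyclic-predecessor u<m ⟨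
  (m ∸ 1 + suc u % m) % m    ≡⟨ cong (λ x → (m ∸ 1 + x) % m) eq ⟩
  (m ∸ 1 + suc v % m) % m    ≡⟨ cyclic-predecessor v<m ⟩
  v                          ∎

two-successors : ∀ {m a b c} .{{_ : NonZero m}} → b ≡ suc a % m → c ≡ suc b % m → c ≡ (2 + a) % m
two-successors {m} {a} refl refl = %-absorbʳ 1 (suc a) m

cycle-two-step : ∀ {m} .{{_ : NonZero m}} {u w v : Fin m} → CycleAdj m u w → CycleAdj m w v → u ≢ v →
  (toℕ v ≡ (2 + toℕ u) % m) ⊎ (toℕ u ≡ (2 + toℕ v) % m)
cycle-two-step (inj₁ w≡u+1) (inj₁ v≡w+1) _   = inj₁ (two-successors w≡u+1 v≡w+1)
cycle-two-step (inj₁ w≡u+1) (inj₂ w≡v+1) u≢v =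
  ⊥-elim (u≢v (toℕ-injective (suc-mod-injective (toℕ<n _) (toℕ<n _) (trans (sym w≡u+1) w≡v+1))))
cycle-two-step (inj₂ u≡w+1) (inj₁ v≡w+1) u≢v = ⊥-elim (u≢v (toℕ-injective (trans u≡w+1 (sym v≡w+1))))
cycle-two-step (inj₂ u≡w+1) (inj₂ w≡v+1) _   = inj₂ (two-successors w≡v+1 u≡w+1)

row : ∀ {m} → Fin m → Fin 3
row i = toℕ i mod 3

residue-shift : ∀ u → (suc u % 3 ≢ u % 3) × (suc (suc u) % 3 ≢ u % 3)
residue-shift 0 = (λ ()) , (λ ())
residue-shift 1 = (λ ()) , (λ ())
residue-shift 2 = (λ ()) , (λ ())
residue-shift (suc (suc (suc u))) = residue-shift u

-- Since 3 ∣ m, reducing mod m does not affect residues mod 3.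
row-after : ∀ {m} .{{_ : NonZero m}} {u v : Fin m} → 3 ∣ m → ∀ d →
  toℕ v ≡ (d + toℕ u) % m → (d + toℕ u) % 3 ≢ toℕ u % 3 → row u ≢ row v
row-after {m} {u} {v} 3∣m d v≡u+d shifted row-eq = shifted (begin
  (d + toℕ u) % 3      ≡⟨ m∣n⇒o%n%m≡o%m 3 m (d + toℕ u) 3∣m ⟨
  (d + toℕ u) % m % 3  ≡⟨ cong (_% 3) v≡u+d ⟨
  toℕ v % 3            ≡⟨ toℕ-fromℕ< (m%n<n (toℕ v) 3) ⟨
  toℕ (row v)          ≡⟨ cong toℕ row-eq ⟨
  toℕ (row u)          ≡⟨ toℕ-fromℕ< (m%n<n (toℕ u) 3) ⟩
  toℕ u % 3            ∎)

rows-differ-at-distance-one : ∀ {m} .{{_ : NonZero m}} {i i′ : Fin m} → 3 ∣ m →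
  CycleAdj m i i′ → row i ≢ row i′
rows-differ-at-distance-one {i = i} 3∣m (inj₁ e) = row-after 3∣m 1 e (proj₁ (residue-shift (toℕ i)))
rows-differ-at-distance-one {i′ = i′} 3∣m (inj₂ e) =
  ≢-sym (row-after 3∣m 1 e (proj₁ (residue-shift (toℕ i′))))

rows-differ-at-distance-two : ∀ {m} .{{_ : NonZero m}} {i w i′ : Fin m} → 3 ∣ m →
  CycleAdj m i w → CycleAdj m w i′ → i ≢ i′ → row i ≢ row i′
rows-differ-at-distance-two {i = i} {i′ = i′} 3∣m iw wi′ i≢i′ with cycle-two-step iw wi′ i≢i′
... | inj₁ e = row-after 3∣m 2 e (proj₂ (residue-shift (toℕ i)))
... | inj₂ e = ≢-sym (row-after 3∣m 2 e (proj₂ (residue-shift (toℕ i′))))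

module _ {c} (n : ℕ) .{{_ : NonZero n}} (W : ℕ → Column c)
         (periodic : ∀ t → W (t % n) ≡ W t) (proper : ∀ t → t < n → ProperAt W t) where

  private
    column-after : ∀ d {u v : Fin n} → toℕ v ≡ (d + toℕ u) % n → W (toℕ v) ≡ W (d + toℕ u)
    column-after d v≡u+d = trans (cong W v≡u+d) (periodic _)

    proper-column : (j : Fin n) → ProperAt W (toℕ j)
    proper-column j = proper (toℕ j) (toℕ<n j)

  -- Periodicity turns the local constraints into constraints between
  -- neighbouring and second-neighbouring columns of the cycle C_n.
  neighbouring-columns-disjoint : {j j′ : Fin n} → CycleAdj n j j′ → Disjoint (W (toℕ j)) (W (toℕ j′))
  neighbouring-columns-disjoint {j} (inj₁ e) =
    subst (Disjoint _) (sym (column-after 1 e)) (disjoint (proper-column j))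
  neighbouring-columns-disjoint {j′ = j′} (inj₂ e) =
    Disjoint-sym (subst (Disjoint _) (sym (column-after 1 e)) (disjoint (proper-column j′)))

  columns-at-distance-two-apart : {j w j′ : Fin n} → CycleAdj n j w → CycleAdj n w j′ → j ≢ j′ →
    Apart (W (toℕ j)) (W (toℕ j′))
  columns-at-distance-two-apart {j} {j′ = j′} jw wj′ j≢j′ with cycle-two-step jw wj′ j≢j′
  ... | inj₁ e = subst (Apart _) (sym (column-after 2 e)) (apart (proper-column j))
  ... | inj₂ e = Apart-sym (subst (Apart _) (sym (column-after 2 e)) (apart (proper-column j′)))

  periodic-column-colouring : ∀ k .{{_ : NonZero (3 * k)}} → χ≤ (square (T k n)) c
  periodic-column-colouring k = colour , colour-proper
    where
    3∣m : 3 ∣ 3 * k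
    3∣m = m∣m*n k

    colour : Fin (3 * k) × Fin n → Fin c
    colour (i , j) = W (toℕ j) (row i)

    colour-proper : IsProperColouring (square (T k n)) c colour
    colour-proper (i , j) (i′ , .j) (_ , inj₁ (inj₁ (ii′ , refl))) =
      distinct (proper-column j) (row i) (row i′) (rows-differ-at-distance-one 3∣m ii′)
    colour-proper (i , j) (.i , j′) (_ , inj₁ (inj₂ (refl , jj′))) =
      neighbouring-columns-disjoint jj′ (row i) (row i)
    colour-proper (i , j) (i′ , .j) (ne , inj₂ (_ , inj₁ (iw , refl) , inj₁ (wi′ , refl))) =
      distinct (proper-column j) (row i) (row i′)
        (rows-differ-at-distance-two 3∣m iw wi′ (λ i≡i′ → ne (cong (_, j) i≡i′)))
    colour-proper (i , j) (i′ , j′) (_ , inj₂ (_ , inj₁ (_ , refl) , inj₂ (refl , jj′))) =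
      neighbouring-columns-disjoint jj′ (row i) (row i′)
    colour-proper (i , j) (i′ , j′) (_ , inj₂ (_ , inj₂ (refl , jj′) , inj₁ (_ , refl))) =
      neighbouring-columns-disjoint jj′ (row i) (row i′)
    colour-proper (i , j) (.i , j′) (ne , inj₂ (_ , inj₂ (refl , jw) , inj₂ (refl , wj′))) =
      columns-at-distance-two-apart jw wj′ (λ j≡j′ → ne (cong (i ,_) j≡j′)) (row i)

closing-up : ∀ {c} (S : ℕ → Column c) l → LocallyProper S → Closes S l →
  ∀ r → r < 2 + l → ProperAt (λ t → S (t % (2 + l))) r
closing-up S l proper (seam-disjoint , seam-apart₀ , seam-apart₁) r r<n = by-position r r<n (<-cmp r l)
  where
  W : ℕ → Column _
  W t = S (t % (2 + l))

  unchanged : ∀ {t} → t < 2 + l → S t ≡ W t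
  unchanged t<n = cong S (sym (m<n⇒m%n≡m t<n))

  wraps-to-0 : S 0 ≡ W (2 + l)
  wraps-to-0 = cong S (sym (n%n≡0 (2 + l)))

  wraps-to-1 : S 1 ≡ W (3 + l)
  wraps-to-1 = cong S (sym ([m+n]%n≡m%n 1 (2 + l)))

  by-position : ∀ r → r < 2 + l → Tri (r < l) (r ≡ l) (l < r) → ProperAt W r
  by-position r _ (tri< r<l _ _) =
    ProperTriple-resp (unchanged (≤-trans r<l (m≤n+m l 2))) (unchanged (s≤s (≤-trans r<l (m≤n+m l 1))))
      (unchanged (s≤s (s≤s r<l))) (proper r)
  by-position r _ (tri≈ _ refl _) =
    ProperTriple-resp (unchanged (m≤n+m (suc r) 1)) (unchanged ≤-refl) wraps-to-0
      (proper-triple (distinct (proper l)) (disjoint (proper l)) seam-apart₀)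
  by-position r r<n (tri> _ _ l<r) rewrite ≤-antisym (≤-pred r<n) l<r =
    ProperTriple-resp (unchanged ≤-refl) wraps-to-0 wraps-to-1
      (proper-triple (distinct (proper (suc l))) seam-disjoint seam-apart₁)

closed-sequence-colouring : ∀ {c} k l .{{_ : NonZero (3 * k)}} (S : ℕ → Column c) →
  LocallyProper S → Closes S l → χ≤ (square (T k (2 + l))) c
closed-sequence-colouring k l S proper closes =
  periodic-column-colouring (2 + l) (λ t → S (t % (2 + l))) (λ t → cong S (m%n%n≡m%n t (2 + l)))
    (closing-up S l proper closes) k

periodic-induction : ∀ {ℓ} (P : ℕ → Set ℓ) (b p : ℕ) → 0 < p →
  (∀ t → b ≤ t → P t → P (p + t)) → (∀ {t} → t < b + p → P t) → ∀ t → P t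
periodic-induction P b p 0<p step base = <-rec P induct
  where
  induct : ∀ t → (∀ {s} → s < t → P s) → P t
  induct t earlier with t <? b + p
  ... | yes t<b+p = base t<b+p
  ... | no t≮b+p =
    subst P (m+[n∸m]≡n p≤t) (step (t ∸ p) (m+n≤o⇒m≤o∸n b b+p≤t) (earlier (∸-monoʳ-< 0<p p≤t)))
    where
    b+p≤t : b + p ≤ t
    b+p≤t = ≮⇒≥ t≮b+p
    p≤t : p ≤ t
    p≤t = m+n≤o⇒n≤o b b+p≤t

record PeriodicFrom {c} (a p : ℕ) (S : ℕ → Column c) : Set where
  constructor periodic-from
  field repeats : ∀ t → S (p + (a + t)) ≡ S (a + t)
open PeriodicFrom

periodic-shift : ∀ {c a p t} {S : ℕ → Column c} → PeriodicFrom a p S → a ≤ t →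
  ∀ d → S (d + (p + t)) ≡ S (d + t)
periodic-shift {a = a} {p} {t} {S} periodic a≤t d = begin
  S (d + (p + t))              ≡⟨ cong S d+[p+t]≡p+[d+t] ⟩
  S (p + (d + t))              ≡⟨ cong (λ x → S (p + x)) (m+[n∸m]≡n a≤d+t) ⟨
  S (p + (a + (d + t ∸ a)))    ≡⟨ repeats periodic (d + t ∸ a) ⟩
  S (a + (d + t ∸ a))          ≡⟨ cong S (m+[n∸m]≡n a≤d+t) ⟩
  S (d + t)                    ∎
  where
  a≤d+t : a ≤ d + t
  a≤d+t = ≤-trans a≤t (m≤n+m t d)
  d+[p+t]≡p+[d+t] : d + (p + t) ≡ p + (d + t)
  d+[p+t]≡p+[d+t] = trans (sym (+-assoc d p t)) (trans (cong (_+ t) (+-comm d p)) (+-assoc p d t))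

proper-by-check : ∀ {c a p} {S : ℕ → Column c} → PeriodicFrom a p S → 0 < p →
  True (allUpTo? (properAt? S) (a + p)) → LocallyProper S
proper-by-check {a = a} {p} {S} periodic 0<p check =
  periodic-induction (ProperAt S) a p 0<p step (toWitness check)
  where
  step : ∀ t → a ≤ t → ProperAt S t → ProperAt S (p + t)
  step t a≤t = ProperTriple-resp (sym (shift 0)) (sym (shift 1)) (sym (shift 2))
    where
    shift : ∀ d → S (d + (p + t)) ≡ S (d + t)
    shift = periodic-shift {p = p} {S = S} periodic a≤t

closes-by-check : ∀ {c a p} {S : ℕ → Column c} → PeriodicFrom a p S → 0 < p →
  (Q : ℕ → Set) (Q? : Decidable Q) → (∀ l → a ≤ l → Q (p + l) → Q l) →
  True (allUpTo? (λ l → Q? l →-dec closes? S l) (a + p)) → ∀ l → Q l → Closes S l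
closes-by-check {a = a} {p} {S} periodic 0<p Q Q? back check =
  periodic-induction (λ l → Q l → Closes S l) a p 0<p step (toWitness check)
  where
  step : ∀ l → a ≤ l → (Q l → Closes S l) → Q (p + l) → Closes S (p + l)
  step l a≤l closes-at-l q with closes-at-l (back l a≤l q)
  ... | seam-disjoint , seam-apart₀ , seam-apart₁ =
    subst (λ C → Disjoint C (S 0)) (sym (shift 1)) seam-disjoint ,
    subst (λ C → Apart C (S 0)) (sym (shift 0)) seam-apart₀ ,
    subst (λ C → Apart C (S 1)) (sym (shift 1)) seam-apart₁
    where
    shift : ∀ d → S (d + (p + l)) ≡ S (d + l)
    shift = periodic-shift {p = p} {S = S} periodic a≤l

-- Any two A's (B's) are apart and every A is disjoint from every B.  The
-- columns alternate A, B with rotations 2 2 | 0 0 1 1 | 0 0 1 1 | …, so the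
-- seam joins the pair A₀B₀ or A₁B₁ to the initial pair A₂B₂.
A₀ A₁ A₂ B₀ B₁ B₂ : Column 6
A₀ = # 0 ∷ # 1 ∷ # 2 ∷ []
A₁ = # 1 ∷ # 2 ∷ # 0 ∷ []
A₂ = # 2 ∷ # 0 ∷ # 1 ∷ []
B₀ = # 3 ∷ # 4 ∷ # 5 ∷ []
B₁ = # 4 ∷ # 5 ∷ # 3 ∷ []
B₂ = # 5 ∷ # 3 ∷ # 4 ∷ []

evenColumns : ℕ → Column 6
evenColumns 0 = A₂
evenColumns 1 = B₂
evenColumns 2 = A₀
evenColumns 3 = B₀
evenColumns 4 = A₁
evenColumns 5 = B₁
evenColumns (suc (suc (suc (suc (suc (suc t)))))) = evenColumns (suc (suc t))

evenColumns-periodic : PeriodicFrom 2 4 evenColumns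
evenColumns-periodic = periodic-from λ _ → refl

evenColumns-proper : LocallyProper evenColumns
evenColumns-proper = proper-by-check evenColumns-periodic (s≤s z≤n) _

evenColumns-close : ∀ l → 1 ≤ l × l % 2 ≡ 0 → Closes evenColumns l
evenColumns-close =
  closes-by-check evenColumns-periodic (s≤s z≤n) _ (λ l → (1 ≤? l) ×-dec (l % 2 ≟ℕ 0))
  (λ l 2≤l (_ , even) → ≤-trans (s≤s z≤n) 2≤l , even) _

-- Odd n ≥ 7, 7 colours: five transitional columns followed by the 4-periodic
-- pattern of rotations of (0,1,2) and (3,4,5); colour 6 is needed only in
-- the transition.
oddColumns : ℕ → Column 7
oddColumns 0 = # 2 ∷ # 0 ∷ # 6 ∷ []
oddColumns 1 = # 1 ∷ # 3 ∷ # 4 ∷ []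
oddColumns 2 = # 0 ∷ # 6 ∷ # 5 ∷ []
oddColumns 3 = # 2 ∷ # 1 ∷ # 3 ∷ []
oddColumns 4 = # 5 ∷ # 4 ∷ # 6 ∷ []
oddColumns 5 = # 1 ∷ # 2 ∷ # 0 ∷ []
oddColumns 6 = # 4 ∷ # 5 ∷ # 3 ∷ []
oddColumns 7 = # 0 ∷ # 1 ∷ # 2 ∷ []
oddColumns 8 = # 3 ∷ # 4 ∷ # 5 ∷ []
oddColumns (suc (suc (suc (suc (suc (suc (suc (suc (suc t))))))))) =
  oddColumns (suc (suc (suc (suc (suc t)))))

oddColumns-periodic : PeriodicFrom 5 4 oddColumns
oddColumns-periodic = periodic-from λ _ → refl

oddColumns-proper : LocallyProper oddColumns
oddColumns-proper = proper-by-check oddColumns-periodic (s≤s z≤n) _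

oddColumns-close : ∀ l → 5 ≤ l × l % 2 ≡ 1 → Closes oddColumns l
oddColumns-close =
  closes-by-check oddColumns-periodic (s≤s z≤n) _ (λ l → (5 ≤? l) ×-dec (l % 2 ≟ℕ 1))
  (λ l 5≤l (_ , odd) → 5≤l , odd) _

fiveColumns : ℕ → Column 8
fiveColumns 0 = # 0 ∷ # 1 ∷ # 2 ∷ []
fiveColumns 1 = # 3 ∷ # 4 ∷ # 5 ∷ []
fiveColumns 2 = # 1 ∷ # 0 ∷ # 6 ∷ []
fiveColumns 3 = # 2 ∷ # 3 ∷ # 4 ∷ []
fiveColumns 4 = # 5 ∷ # 6 ∷ # 7 ∷ []
fiveColumns (suc (suc (suc (suc (suc t))))) = fiveColumns t

fiveColumns-periodic : PeriodicFrom 0 5 fiveColumns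
fiveColumns-periodic = periodic-from λ _ → refl

fiveColumns-proper : LocallyProper fiveColumns
fiveColumns-proper = proper-by-check fiveColumns-periodic (s≤s z≤n) _

fiveColumns-close : Closes fiveColumns 3
fiveColumns-close = toWitness {a? = closes? fiveColumns 3} _

threeColumns : ℕ → Column 9
threeColumns 0 = # 0 ∷ # 1 ∷ # 2 ∷ []
threeColumns 1 = # 3 ∷ # 4 ∷ # 5 ∷ []
threeColumns 2 = # 6 ∷ # 7 ∷ # 8 ∷ []
threeColumns (suc (suc (suc t))) = threeColumns t

threeColumns-periodic : PeriodicFrom 0 3 threeColumns
threeColumns-periodic = periodic-from λ _ → refl

threeColumns-proper : LocallyProper threeColumns
threeColumns-proper = proper-by-check threeColumns-periodic (s≤s z≤n) _

threeColumns-close : Closes threeColumns 1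
threeColumns-close = toWitness {a? = closes? threeColumns 1} _

corollary2 : (k n : ℕ) → k ≥ 1 → n ≥ 3 → .{{_ : NonZero (3 * k)}} → .{{_ : NonZero n}} →
    ((n % 2 ≡ 0 → χ≤ (square (T k n)) 6)
    × (n % 2 ≡ 1 → n ≥ 7 → χ≤ (square (T k n)) 7)
    × (n ≡ 5 → χ≤ (square (T k n)) 8)
    × (n ≡ 3 → χ≤ (square (T k n)) 9))
corollary2 k 1 _ (s≤s ())
corollary2 k 2 _ (s≤s (s≤s ()))
corollary2 k (suc (suc (suc l))) _ _ =
    (λ even → closed-sequence-colouring k (suc l) evenColumns evenColumns-proper
                (evenColumns-close (suc l) (s≤s z≤n , even)))
  , (λ odd n≥7 → closed-sequence-colouring k (suc l) oddColumns oddColumns-proper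
                   (oddColumns-close (suc l) (≤-pred (≤-pred n≥7) , odd)))
  , (λ { refl → closed-sequence-colouring k 3 fiveColumns fiveColumns-proper fiveColumns-close })
  , (λ { refl → closed-sequence-colouring k 1 threeColumns threeColumns-proper threeColumns-close })
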